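{- The map $(\mathfrak{Lie}(B),\{ -,-\}_A)\to\mathrm{End}_{\mathbb{Q}}(\mathbb{Q}\langle B\rangle)$, $\psi\mapsto\sigma_\psi$, is a Lie algebra morphism, where $\mathrm{End}_{\mathbb{Q}}(\mathbb{Q}\langle B\rangle)$ carries the commutator bracket; i.e. it defines a Lie algebra action of $(\mathfrak{Lie}(B),\{ -,-\}_A)$ on $\mathbb{Q}\langle B\rangle$ by linear endomorphisms.
   Context: Let $B=\{b_0,b_1,b_2,\dots\}$, $\mathbb{Q}\langle B\rangle$ the free associative $\mathbb{Q}$-algebra on $B$, and $\mathfrak{Lie}(B)\subset\mathbb{Q}\langle B\rangle$ the free Lie algebra on $B$. For a word $w=b_0^{m_1}b_{k_1}\cdots b_0^{m_d}b_{k_d}b_0^{m_{d+1}}$ ($d\ge1$, $k_i\ge1$, $m_i\ge0$), $\mathbf{k}=(k_1,\dots,k_d)$ and $\mathbf{l}\in\mathbb{Z}_{>0}^d$, let $w(\mathbf{l})$ be obtained by replacing each $b_{k_i}$ by $b_{l_i}$, $|\mathbf{k}|=\sum k_i$, $\binom{\mathbf{k}-1}{\mathbf{l}-1}=\prod_i\binom{k_i-1}{l_i-1}$, $\mathbf{l}\le\mathbf{k}$ componentwise. Let $\partial_w$ be the derivation of $\mathbb{Q}\langle B\rangle$ with $\partial_w(b_0)=0$ and $\partial_w(b_i)=\sum_{\mathbf{l}\le\mathbf{k}}(-1)^{|\mathbf{k}|+|\mathbf{l}|}\binom{\mathbf{k}-1}{\mathbf{l}-1}[b_{i+|\mathbf{k}|-|\mathbf{l}|},w(\mathbf{l})]$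 for $i\ge1$; if $w=b_0^m$ ($m\ge1$), $\partial_w(b_0)=0$, $\partial_w(b_i)=[b_i,w]$; extend linearly in $w$. The bracket $\{\psi_1,\psi_2\}_A=\partial_{\psi_1}(\psi_2)-\partial_{\psi_2}(\psi_1)+[\psi_1,\psi_2]$ is a Lie bracket on $\mathfrak{Lie}(B)$. For $\psi\in\mathfrak{Lie}(B)$, $\sigma_\psi=\ell_\psi+\partial_\psi$, with $\ell_\psi$ left multiplication by $\psi$. -}

module Defs where

open import Data.Nat as ℕ using (ℕ; zero; suc)
open import Data.Nat.Combinatorics using (_C_)
open import Data.Integer using (+_)
open import Data.Rational as ℚ using (ℚ; 0ℚ; 1ℚ; _/_)
open import Data.List using (List; []; _∷_; _++_; map; concatMap; upTo; foldr)
open import Data.List.Properties using (≡-dec)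
open import Data.Product using (_×_; _,_; Σ)
open import Relation.Nullary using (yes; no)
open import Relation.Binary.PropositionalEquality using (_≡_)

-- Words over B = {b₀, b₁, …}: a letter b_i is represented by i : ℕ.

Word : Set
Word = List ℕ

-- Elements of ℚ⟨B⟩: finite formal ℚ-linear combinations of words
-- (representatives; equality is the setoid _≈_ below).
Poly : Set
Poly = List (ℚ × Word)

coeff : Poly → Word → ℚ
coeff [] w = 0ℚ
coeff ((c , u) ∷ p) w with ≡-dec ℕ._≟_ u w
... | yes _ = c ℚ.+ coeff p w
... | no  _ = coeff p w

infix 4 _≈_
_≈_ : Poly → Poly → Set
p ≈ q = ∀ w → coeff p w ≡ coeff q w

𝟘 : Poly
𝟘 = []

infixl 6 _⊕_ _⊖_
infixl 7 _⊛_ _·_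

_⊕_ : Poly → Poly → Poly
p ⊕ q = p ++ q

_·_ : ℚ → Poly → Poly
a · p = map (λ { (c , u) → (a ℚ.* c , u) }) p

_⊖_ : Poly → Poly → Poly
p ⊖ q = p ⊕ (ℚ.- 1ℚ) · q

_⊛_ : Poly → Poly → Poly
p ⊛ q = concatMap (λ { (c , u) → map (λ { (d , v) → (c ℚ.* d , u ++ v) }) q }) p

word : Word → Poly
word w = (1ℚ , w) ∷ []

letter : ℕ → Poly
letter i = word (i ∷ [])

⟦_,_⟧ : Poly → Poly → Poly
⟦ p , q ⟧ = p ⊛ q ⊖ q ⊛ p

sumP : List Poly → Poly
sumP = foldr _⊕_ 𝟘

-- The free Lie algebra 𝔏𝔦𝔢(B) ⊂ ℚ⟨B⟩: the smallest subspace containing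
-- the letters and closed under commutators (closed under _≈_).

data IsLie : Poly → Set where
  gen   : ∀ i → IsLie (letter i)
  zer   : IsLie 𝟘
  add   : ∀ {p q} → IsLie p → IsLie q → IsLie (p ⊕ q)
  scal  : ∀ a {p} → IsLie p → IsLie (a · p)
  brk   : ∀ {p q} → IsLie p → IsLie q → IsLie ⟦ p , q ⟧
  resp  : ∀ {p q} → p ≈ q → IsLie p → IsLie q

ℕtoℚ : ℕ → ℚ
ℕtoℚ n = + n / 1

sgn : ℕ → ℚ
sgn zero = 1ℚ
sgn (suc n) = ℚ.- sgn n

-- For w = b₀^{m₁} b_{k₁} ⋯ b₀^{m_d} b_{k_d} b₀^{m_{d+1}}, the list of all
-- triples ( (-1)^{|k|+|l|} binom(k-1,l-1) , |k| - |l| , w(l) )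
-- for l ≤ k with all l_i ≥ 1.  (Note (-1)^{|k|+|l|} = ∏ (-1)^{k_i-l_i}.)
variants : Word → List (ℚ × ℕ × Word)
variants [] = (1ℚ , 0 , []) ∷ []
variants (zero ∷ w) = map (λ { (c , s , v) → (c , s , zero ∷ v) }) (variants w)
variants (suc k′ ∷ w) =
  concatMap (λ j →            -- l = suc j, with 0 ≤ j ≤ k′ = k - 1
    map (λ { (c , s , v) →
          ( sgn (k′ ℕ.∸ j) ℚ.* ℕtoℚ (k′ C j) ℚ.* c
          , (k′ ℕ.∸ j) ℕ.+ s
          , suc j ∷ v) })
        (variants w))
    (upTo (suc k′))

hasNonzero : Word → Set
hasNonzero [] = Data.Empty.⊥ where import Data.Empty
hasNonzero (zero ∷ w) = hasNonzero w
hasNonzero (suc _ ∷ w) = Data.Unit.⊤ where import Data.Unit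

data Shape : Word → Set where
  nonzero : ∀ {w} → hasNonzero w → Shape w
  pureB0  : ∀ m → Shape (Data.List.replicate (suc m) zero)
  empty   : Shape []

shape : (w : Word) → Shape w
shape [] = empty
shape (suc k ∷ w) = nonzero _
shape (zero ∷ w) with shape w
... | nonzero h = nonzero h
... | pureB0 m = pureB0 (suc m)
... | empty = pureB0 0

∂letter : Word → ℕ → Poly
∂letter w zero = 𝟘
∂letter w (suc i′) with shape w
... | nonzero _ = sumP (map (λ { (c , s , v) → c · ⟦ letter (suc i′ ℕ.+ s) , word v ⟧ }) (variants w))
... | pureB0 m = ⟦ letter (suc i′) , word w ⟧
... | empty = 𝟘   -- w = 1 is not in 𝔏𝔦𝔢(B); convention ∂_1 = 0

∂word : Word → Word → Poly
∂word w [] = 𝟘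
∂word w (i ∷ u) = ∂letter w i ⊛ word u ⊕ letter i ⊛ ∂word w u

∂ : Poly → Poly → Poly
∂ ψ f = concatMap (λ { (c , w) → concatMap (λ { (d , u) → (c ℚ.* d) · ∂word w u }) f }) ψ

⟪_,_⟫A : Poly → Poly → Poly
⟪ ψ₁ , ψ₂ ⟫A = ∂ ψ₁ ψ₂ ⊖ ∂ ψ₂ ψ₁ ⊕ ⟦ ψ₁ , ψ₂ ⟧

σ : Poly → Poly → Poly
σ ψ f = ψ ⊛ f ⊕ ∂ ψ f

-- All identities are tested against linear functionals h : Word → ℚ, through ev h p = Σ c · h u over the
-- terms c · u of p (equality of coefficients is the case h = δ w). Transposing, ev h (σ ψ f) = ev (σ* ψ h) f,
-- so the theorem becomes an identity in ℚ which is bilinear in ψ and φ and hence reduces to words a and b.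
-- Since σ_a = ℓ_a + ∂_a and ∂_a (b u) = ∂_a(b) u + b ∂_a(u), the word case reduces to
-- [∂_a , ∂_b] = ∂_{∂_a b - ∂_b a + ab - ba}; both sides are derivations, so it suffices to compare them on a
-- letter b_n. There ∂_a ∂_b b_n is a sum of nested brackets [[b_N , v] , v′] over the variants of a and b,
-- whose antisymmetrisation is ∂_{ab - ba} b_n by the Jacobi identity, plus the terms [b_N , ∂_a v′], which
-- add up to ∂_{∂_a b} b_n because ∂_a commutes with passing to variants. That last fact comes from the
-- generating polynomial ∏ (y_i - x)^(k_i - 1) of the variants of w: it is multiplicative in w and depends only
-- on the differences y_i - x.

module Submission where

open import Defs
open import Data.Rational as ℚ using (ℚ; 0ℚ; 1ℚ; _+_; _*_; -_; _-_; mkℚ)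
open import Data.Rational.Properties as ℚP using (+-*-commutativeRing; _≟_)
open import Data.Nat as ℕ using (ℕ; zero; suc; _∸_; _<_; z≤n; s≤s)
import Data.Nat.Properties as ℕP
import Data.Nat.Coprimality as Coprime
open import Data.Nat.Combinatorics using (_C_; nCk+nC[k+1]≡[n+1]C[k+1]; k>n⇒nCk≡0)
import Data.Integer as ℤ
import Data.Integer.Properties as ℤP
open import Data.List using (List; []; _∷_; _++_; _∷ʳ_; map; concatMap; applyUpTo; upTo; replicate)
open import Data.List.Properties as ListP using (≡-dec)
open import Data.Product using (_×_; _,_)
open import Function using (_∘_)
open import Relation.Nullary using (yes; no)
open import Relation.Binary.PropositionalEquality
open import Algebra.Solver.Ring.AlmostCommutativeRing using (fromCommutativeRing)
open import Algebra.Solver.Ring.Simple (fromCommutativeRing +-*-commutativeRing) _≟_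
  using (solve; _:+_; _:*_; :-_; _:-_; _:=_; con)
open ≡-Reasoning

-- Evaluation against linear functionals

Functional : Set
Functional = Word → ℚ

ev : Functional → Poly → ℚ
ev h [] = 0ℚ
ev h ((c , u) ∷ p) = c * h u + ev h p

ev-++ : ∀ h p q → ev h (p ++ q) ≡ ev h p + ev h q
ev-++ h [] q = sym (ℚP.+-identityˡ (ev h q))
ev-++ h ((c , u) ∷ p) q rewrite ev-++ h p q = sym (ℚP.+-assoc (c * h u) (ev h p) (ev h q))

ev-cong : ∀ {h g} p → (∀ u → h u ≡ g u) → ev h p ≡ ev g p
ev-cong [] h≗g = refl
ev-cong ((c , u) ∷ p) h≗g = cong₂ (λ x y → c * x + y) (h≗g u) (ev-cong p h≗g)

ev-map : ∀ h c (g : Word → Word) (f : ℚ × Word → ℚ × Word) →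
         (∀ d v → f (d , v) ≡ (c * d , g v)) → ∀ q → ev h (map f q) ≡ c * ev (h ∘ g) q
ev-map h c g f f-def [] = sym (ℚP.*-zeroʳ c)
ev-map h c g f f-def ((d , v) ∷ q) rewrite f-def d v | ev-map h c g f f-def q =
  solve 4 (λ c d x y → c :* d :* x :+ c :* y := c :* (d :* x :+ y)) refl c d (h (g v)) (ev (h ∘ g) q)

ev-· : ∀ h a p → ev h (a · p) ≡ a * ev h p
ev-· h a = ev-map h a (λ v → v) _ (λ _ _ → refl)

ev-⊛ : ∀ h p q → ev h (p ⊛ q) ≡ ev (λ u → ev (λ v → h (u ++ v)) q) p
ev-⊛ h [] q = refl
ev-⊛ h ((c , u) ∷ p) q =
  trans (ev-++ h (map _ q) (p ⊛ q)) (cong₂ _+_ (ev-map h c (u ++_) _ (λ _ _ → refl) q) (ev-⊛ h p q))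

ev-word : ∀ h w → ev h (word w) ≡ h w
ev-word h w = trans (ℚP.+-identityʳ _) (ℚP.*-identityˡ _)

ev-⊖ : ∀ h p q → ev h (p ⊖ q) ≡ ev h p - ev h q
ev-⊖ h p q = begin
  ev h (p ++ (- 1ℚ) · q)        ≡⟨ ev-++ h p _ ⟩
  ev h p + ev h ((- 1ℚ) · q)    ≡⟨ cong (ev h p +_) (ev-· h (- 1ℚ) q) ⟩
  ev h p + (- 1ℚ) * ev h q      ≡⟨ solve 2 (λ x y → x :+ (:- con 1ℚ) :* y := x :- y) refl (ev h p) (ev h q) ⟩
  ev h p - ev h q               ∎

ev-lincomb : ∀ h a b p q → ev h (a · p ⊕ b · q) ≡ a * ev h p + b * ev h q
ev-lincomb h a b p q = trans (ev-++ h (a · p) (b · q)) (cong₂ _+_ (ev-· h a p) (ev-· h b q))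

ev-+ : ∀ h g p → ev (λ u → h u + g u) p ≡ ev h p + ev g p
ev-+ h g [] = sym (ℚP.+-identityˡ 0ℚ)
ev-+ h g ((c , u) ∷ p) rewrite ev-+ h g p =
  solve 5 (λ c x y a b → c :* (x :+ y) :+ (a :+ b) := c :* x :+ a :+ (c :* y :+ b)) refl c (h u) (g u) (ev h p) (ev g p)

ev-* : ∀ a h p → ev (λ u → a * h u) p ≡ a * ev h p
ev-* a h [] = sym (ℚP.*-zeroʳ a)
ev-* a h ((c , u) ∷ p) rewrite ev-* a h p =
  solve 4 (λ a c x y → c :* (a :* x) :+ a :* y := a :* (c :* x :+ y)) refl a c (h u) (ev h p)

ev-- : ∀ h g p → ev (λ u → h u - g u) p ≡ ev h p - ev g p
ev-- h g [] = sym (ℚP.+-inverseʳ 0ℚ)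
ev-- h g ((c , u) ∷ p) rewrite ev-- h g p =
  solve 5 (λ c x y a b → c :* (x :- y) :+ (a :- b) := c :* x :+ a :- (c :* y :+ b)) refl c (h u) (g u) (ev h p) (ev g p)

ev-0 : ∀ p → ev (λ _ → 0ℚ) p ≡ 0ℚ
ev-0 [] = refl
ev-0 ((c , u) ∷ p) rewrite ev-0 p = trans (ℚP.+-identityʳ (c * 0ℚ)) (ℚP.*-zeroʳ c)

ev-swap : ∀ (F : Word → Word → ℚ) p q → ev (λ u → ev (F u) q) p ≡ ev (λ v → ev (λ u → F u v) p) q
ev-swap F [] q = sym (ev-0 q)
ev-swap F ((c , u) ∷ p) q = begin
  c * ev (F u) q + ev (λ u → ev (F u) q) p
    ≡⟨ cong₂ _+_ (sym (ev-* c (F u) q)) (ev-swap F p q) ⟩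
  ev (λ v → c * F u v) q + ev (λ v → ev (λ u → F u v) p) q
    ≡⟨ sym (ev-+ (λ v → c * F u v) (λ v → ev (λ u → F u v) p) q) ⟩
  ev (λ v → c * F u v + ev (λ u → F u v) p) q ∎

δ : Word → Functional
δ w u with ≡-dec ℕ._≟_ u w
... | yes _ = 1ℚ
... | no  _ = 0ℚ

coeff≡ev-δ : ∀ p w → coeff p w ≡ ev (δ w) p
coeff≡ev-δ [] w = refl
coeff≡ev-δ ((c , u) ∷ p) w with ≡-dec ℕ._≟_ u w
... | yes _ = cong₂ _+_ (sym (ℚP.*-identityʳ c)) (coeff≡ev-δ p w)
... | no  _ = trans (coeff≡ev-δ p w) (sym (trans (cong (_+ ev (δ w) p) (ℚP.*-zeroʳ c)) (ℚP.+-identityˡ _)))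

ev≡⇒≈ : ∀ {p q} → (∀ h → ev h p ≡ ev h q) → p ≈ q
ev≡⇒≈ {p} {q} ev≡ w = trans (coeff≡ev-δ p w) (trans (ev≡ (δ w)) (sym (coeff≡ev-δ q w)))

-- Alternating binomial sums

ℕtoℚ-+ : ∀ a b → ℕtoℚ (a ℕ.+ b) ≡ ℕtoℚ a + ℕtoℚ b
ℕtoℚ-+ a b = begin
  (ℤ.+ a ℤ.+ ℤ.+ b) ℚ./ 1
    ≡⟨ cong₂ (λ x y → (x ℤ.+ y) ℚ./ 1) (sym (ℤP.*-identityʳ (ℤ.+ a))) (sym (ℤP.*-identityʳ (ℤ.+ b))) ⟩
  mkℚ (ℤ.+ a) 0 (coprime-1 a) + mkℚ (ℤ.+ b) 0 (coprime-1 b)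
    ≡⟨ cong₂ _+_ (sym (ℚP.normalize-coprime (coprime-1 a))) (sym (ℚP.normalize-coprime (coprime-1 b))) ⟩
  ℕtoℚ a + ℕtoℚ b ∎
  where
  coprime-1 : ∀ n → Coprime.Coprime n 1
  coprime-1 n = Coprime.sym (Coprime.1-coprimeTo n)

Σ< : ℕ → (ℕ → ℚ) → ℚ
Σ< zero    f = 0ℚ
Σ< (suc n) f = f 0 + Σ< n (f ∘ suc)

Σ<-cong : ∀ n {f g} → (∀ j → j < n → f j ≡ g j) → Σ< n f ≡ Σ< n g
Σ<-cong zero    f≗g = refl
Σ<-cong (suc n) f≗g = cong₂ _+_ (f≗g 0 (s≤s z≤n)) (Σ<-cong n (λ j j<n → f≗g (suc j) (s≤s j<n)))

Σ<-+ : ∀ n f g → Σ< n (λ j → f j + g j) ≡ Σ< n f + Σ< n g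
Σ<-+ zero    f g = sym (ℚP.+-identityˡ 0ℚ)
Σ<-+ (suc n) f g rewrite Σ<-+ n (f ∘ suc) (g ∘ suc) =
  solve 4 (λ a b c d → a :+ b :+ (c :+ d) := a :+ c :+ (b :+ d)) refl (f 0) (g 0) (Σ< n (f ∘ suc)) (Σ< n (g ∘ suc))

Σ<-neg : ∀ n f → Σ< n (λ j → - f j) ≡ - Σ< n f
Σ<-neg zero    f = refl
Σ<-neg (suc n) f rewrite Σ<-neg n (f ∘ suc) =
  solve 2 (λ a b → :- a :+ :- b := :- (a :+ b)) refl (f 0) (Σ< n (f ∘ suc))

Σ<-last : ∀ n f → Σ< (suc n) f ≡ Σ< n f + f n
Σ<-last zero    f = trans (ℚP.+-identityʳ (f 0)) (sym (ℚP.+-identityˡ (f 0)))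
Σ<-last (suc n) f = trans (cong (f 0 +_) (Σ<-last n (f ∘ suc))) (sym (ℚP.+-assoc (f 0) _ _))

Σ<-ev : ∀ n (H : ℕ → Functional) p → Σ< n (λ j → ev (H j) p) ≡ ev (λ u → Σ< n (λ j → H j u)) p
Σ<-ev zero    H p = sym (ev-0 p)
Σ<-ev (suc n) H p = trans (cong (ev (H 0) p +_) (Σ<-ev n (H ∘ suc) p)) (sym (ev-+ (H 0) _ p))

-- Reading f s m as the monomial x^s y^(m-1), Δ k f s is f applied to x^s (y - x)^k.
Δ : ℕ → (ℕ → ℕ → ℚ) → ℕ → ℚ
Δ zero    f s = f s 1
Δ (suc k) f s = Δ k (λ s′ m → f s′ (suc m)) s - Δ k (λ s′ m → f (suc s′) m) s

signedBinomial : ℕ → ℕ → ℚ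
signedBinomial k j = sgn (k ∸ j) * ℕtoℚ (k C j)

-- Pascal's rule (k+1 choose j+1) = (k choose j) + (k choose j+1) splits the sum into the two halves of Δ (suc k).
Σ<-signedBinomial≡Δ : ∀ k f s → Σ< (suc k) (λ j → signedBinomial k j * f ((k ∸ j) ℕ.+ s) (suc j)) ≡ Δ k f s
Σ<-signedBinomial≡Δ zero f s = solve 1 (λ x → con 1ℚ :* con 1ℚ :* x :+ con 0ℚ := x) refl (f s 1)
Σ<-signedBinomial≡Δ (suc k) f s = begin
  T 0 + Σ< (suc k) (T ∘ suc)
    ≡⟨ cong (T 0 +_) (trans (Σ<-cong (suc k) (λ j _ → pascal j)) (Σ<-+ (suc k) A B)) ⟩
  T 0 + (Σ< (suc k) A + Σ< (suc k) B)
    ≡⟨ cong (λ x → T 0 + (Σ< (suc k) A + x)) (Σ<-last k B) ⟩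
  T 0 + (Σ< (suc k) A + (Σ< k B + B k))
    ≡⟨ cong₂ (λ x y → T 0 + (Σ< (suc k) A + (x + y)))
             (trans (Σ<-cong k (λ j j<k → B≡-E∘suc j j<k)) (Σ<-neg k (E ∘ suc))) B-last ⟩
  T 0 + (Σ< (suc k) A + (- Σ< k (E ∘ suc) + 0ℚ))
    ≡⟨ solve 4 (λ σ y a x → :- σ :* con 1ℚ :* y :+ (a :+ (:- x :+ con 0ℚ)) := a :- (σ :* con 1ℚ :* y :+ x))
             refl (sgn k) (f (suc (k ℕ.+ s)) 1) (Σ< (suc k) A) (Σ< k (E ∘ suc)) ⟩
  Σ< (suc k) A - Σ< (suc k) E
    ≡⟨ cong₂ _-_ (Σ<-signedBinomial≡Δ k _ s) (Σ<-signedBinomial≡Δ k _ s) ⟩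
  Δ (suc k) f s ∎
  where
  T A B E : ℕ → ℚ
  T j = signedBinomial (suc k) j * f ((suc k ∸ j) ℕ.+ s) (suc j)
  A j = signedBinomial k j * f ((k ∸ j) ℕ.+ s) (suc (suc j))
  B j = (sgn (k ∸ j) * ℕtoℚ (k C suc j)) * f ((k ∸ j) ℕ.+ s) (suc (suc j))
  E j = signedBinomial k j * f (suc ((k ∸ j) ℕ.+ s)) (suc j)
  pascal : ∀ j → T (suc j) ≡ A j + B j
  pascal j = begin
    sgn (k ∸ j) * ℕtoℚ (suc k C suc j) * X
      ≡⟨ cong (λ n → sgn (k ∸ j) * ℕtoℚ n * X) (sym (nCk+nC[k+1]≡[n+1]C[k+1] k j)) ⟩
    sgn (k ∸ j) * ℕtoℚ (k C j ℕ.+ k C suc j) * X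
      ≡⟨ cong (λ n → sgn (k ∸ j) * n * X) (ℕtoℚ-+ (k C j) (k C suc j)) ⟩
    sgn (k ∸ j) * (ℕtoℚ (k C j) + ℕtoℚ (k C suc j)) * X
      ≡⟨ solve 4 (λ s a b x → s :* (a :+ b) :* x := s :* a :* x :+ s :* b :* x) refl
           (sgn (k ∸ j)) (ℕtoℚ (k C j)) (ℕtoℚ (k C suc j)) X ⟩
    A j + B j ∎
    where X = f ((k ∸ j) ℕ.+ s) (suc (suc j))
  B-last : B k ≡ 0ℚ
  B-last rewrite k>n⇒nCk≡0 (ℕP.n<1+n k) =
    solve 2 (λ a x → a :* con 0ℚ :* x := con 0ℚ) refl (sgn (k ∸ k)) (f ((k ∸ k) ℕ.+ s) (suc (suc k)))
  B≡-E∘suc : ∀ j → j < k → B j ≡ - E (suc j)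
  B≡-E∘suc j j<k rewrite ℕP.+-∸-assoc 1 j<k =
    solve 3 (λ s c x → :- s :* c :* x := :- (s :* c :* x)) refl
      (sgn (k ∸ suc j)) (ℕtoℚ (k C suc j)) (f (suc ((k ∸ suc j) ℕ.+ s)) (suc (suc j)))

Δ-cong : ∀ k {f g} s → (∀ s′ m → f s′ (suc m) ≡ g s′ (suc m)) → Δ k f s ≡ Δ k g s
Δ-cong zero    s f≗g = f≗g s 0
Δ-cong (suc k) s f≗g =
  cong₂ _-_ (Δ-cong k s (λ s′ m → f≗g s′ (suc m))) (Δ-cong k s (λ s′ m → f≗g (suc s′) m))

Δ-+ : ∀ k f g s → Δ k (λ s′ m → f s′ m + g s′ m) s ≡ Δ k f s + Δ k g s
Δ-+ zero    f g s = refl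
Δ-+ (suc k) f g s = trans (cong₂ _-_ (Δ-+ k fᵐ gᵐ s) (Δ-+ k fˢ gˢ s))
  (solve 4 (λ a b c d → a :+ b :- (c :+ d) := a :- c :+ (b :- d)) refl (Δ k fᵐ s) (Δ k gᵐ s) (Δ k fˢ s) (Δ k gˢ s))
  where
  fᵐ gᵐ fˢ gˢ : ℕ → ℕ → ℚ
  fᵐ s′ m = f s′ (suc m)
  gᵐ s′ m = g s′ (suc m)
  fˢ s′ m = f (suc s′) m
  gˢ s′ m = g (suc s′) m

Δ-ev : ∀ k (F : ℕ → ℕ → Functional) p s →
       Δ k (λ s′ m → ev (F s′ m) p) s ≡ ev (λ u → Δ k (λ s′ m → F s′ m u) s) p
Δ-ev zero    F p s = refl
Δ-ev (suc k) F p s =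
  trans (cong₂ _-_ (Δ-ev k (λ s′ m → F s′ (suc m)) p s) (Δ-ev k (λ s′ m → F (suc s′) m) p s)) (sym (ev-- _ _ p))

Δ-suc : ∀ k f s → Δ k (λ s′ m → f (suc s′) m) s ≡ Δ k f (suc s)
Δ-suc zero    f s = refl
Δ-suc (suc k) f s = cong₂ _-_ (Δ-suc k (λ s′ m → f s′ (suc m)) s) (Δ-suc k (λ s′ m → f (suc s′) m) s)

Δ-shift : ∀ k f t s → Δ k (λ s′ m → f (s′ ℕ.+ t) m) s ≡ Δ k f (s ℕ.+ t)
Δ-shift zero    f t s = refl
Δ-shift (suc k) f t s = cong₂ _-_ (Δ-shift k (λ s′ m → f s′ (suc m)) t s) (Δ-shift k (λ s′ m → f (suc s′) m) t s)

-- Variants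

Triple : Set
Triple = ℚ × ℕ × Word

encode : Triple → ℚ × Word
encode (c , s , v) = (c , s ∷ v)

-- A variant (c , |k| - |l| , w(l)) is stored as the word |k| - |l| ∷ w(l) with coefficient c,
-- so that the shift is its first letter; shift and body read it back (junk 0 and [] on []).
variantPoly : Word → Poly
variantPoly w = map encode (variants w)

Var : Word → Functional → ℚ
Var w h = ev h (variantPoly w)

shift : Word → ℕ
shift []      = 0
shift (s ∷ _) = s

body : Word → Word
body []      = []
body (_ ∷ v) = v

ev-encode-cong : ∀ {h g} xs → (∀ s v → h (s ∷ v) ≡ g (s ∷ v)) → ev h (map encode xs) ≡ ev g (map encode xs)
ev-encode-cong [] h≗g = refl
ev-encode-cong ((c , s , v) ∷ xs) h≗g = cong₂ _+_ (cong (c *_) (h≗g s v)) (ev-encode-cong xs h≗g)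

Var-cong : ∀ w {h g} → (∀ s v → h (s ∷ v) ≡ g (s ∷ v)) → Var w h ≡ Var w g
Var-cong w = ev-encode-cong (variants w)

ev-encode-map : ∀ h (f : Triple → Triple) a (t : ℕ → ℕ) (e : Word → Word) →
                (∀ c s v → f (c , s , v) ≡ (a * c , t s , e v)) →
                ∀ xs → ev h (map encode (map f xs)) ≡ ev (λ x → a * h (t (shift x) ∷ e (body x))) (map encode xs)
ev-encode-map h f a t e f-def [] = refl
ev-encode-map h f a t e f-def ((c , s , v) ∷ xs) rewrite f-def c s v =
  cong₂ _+_ (solve 3 (λ a c x → a :* c :* x := c :* (a :* x)) refl a c (h (t s ∷ e v))) (ev-encode-map h f a t e f-def xs)

ev-encode-concatMap : ∀ h (F : ℕ → List Triple) φ n →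
  ev h (map encode (concatMap F (applyUpTo φ n))) ≡ Σ< n (λ j → ev h (map encode (F (φ j))))
ev-encode-concatMap h F φ zero    = refl
ev-encode-concatMap h F φ (suc n) = begin
  ev h (map encode (F (φ 0) ++ concatMap F (applyUpTo (φ ∘ suc) n)))
    ≡⟨ cong (ev h) (ListP.map-++ encode (F (φ 0)) _) ⟩
  ev h (map encode (F (φ 0)) ++ map encode (concatMap F (applyUpTo (φ ∘ suc) n)))
    ≡⟨ ev-++ h (map encode (F (φ 0))) _ ⟩
  ev h (map encode (F (φ 0))) + ev h (map encode (concatMap F (applyUpTo (φ ∘ suc) n)))
    ≡⟨ cong (ev h (map encode (F (φ 0))) +_) (ev-encode-concatMap h F (φ ∘ suc) n) ⟩
  Σ< (suc n) (λ j → ev h (map encode (F (φ j)))) ∎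

insertAt : ℕ → ℕ → Word → Word
insertAt zero    i v       = i ∷ v
insertAt (suc n) i []      = []
insertAt (suc n) i (a ∷ v) = a ∷ insertAt n i v

bumpAt : ℕ → Word → Word
bumpAt n       []      = []
bumpAt zero    (a ∷ v) = suc a ∷ v
bumpAt (suc n) (a ∷ v) = a ∷ bumpAt n v

consΔ : ℕ → Functional → Functional
consΔ k h []      = 0ℚ
consΔ k h (s ∷ v) = Δ k (λ s′ m → h (s′ ∷ m ∷ v)) s

Var-[] : ∀ h → Var [] h ≡ h (0 ∷ [])
Var-[] h = ev-word h (0 ∷ [])

Var-b₀∷ : ∀ w h → Var (0 ∷ w) h ≡ Var w (h ∘ insertAt 1 0)
Var-b₀∷ w h = trans
  (ev-encode-map h _ 1ℚ (λ s → s) (0 ∷_) (λ c s v → cong (λ z → (z , s , 0 ∷ v)) (sym (ℚP.*-identityˡ c)))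
                 (variants w))
  (Var-cong w (λ s v → ℚP.*-identityˡ _))

Var-b₊∷ : ∀ k w h → Var (suc k ∷ w) h ≡ Var w (consΔ k h)
Var-b₊∷ k w h = begin
  ev h (map encode (concatMap F (upTo (suc k))))
    ≡⟨ ev-encode-concatMap h F (λ j → j) (suc k) ⟩
  Σ< (suc k) (λ j → ev h (map encode (F j)))
    ≡⟨ Σ<-cong (suc k) (λ j _ →
         ev-encode-map h _ (signedBinomial k j) ((k ∸ j) ℕ.+_) (suc j ∷_) (λ _ _ _ → refl) xs) ⟩
  Σ< (suc k) (λ j → ev (H j) (map encode xs))
    ≡⟨ Σ<-ev (suc k) H (map encode xs) ⟩
  ev (λ x → Σ< (suc k) (λ j → H j x)) (map encode xs)
    ≡⟨ ev-encode-cong xs (λ s v → Σ<-signedBinomial≡Δ k (λ s′ m → h (s′ ∷ m ∷ v)) s) ⟩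
  Var w (consΔ k h) ∎
  where
  xs = variants w
  F : ℕ → List Triple
  F j = map (λ { (c , s , v) → (signedBinomial k j * c , (k ∸ j) ℕ.+ s , suc j ∷ v) }) xs
  H : ℕ → Functional
  H j x = signedBinomial k j * h ((k ∸ j) ℕ.+ shift x ∷ suc j ∷ body x)

Var-single : ∀ k G → Var (suc k ∷ []) G ≡ Δ k (λ s m → G (s ∷ m ∷ [])) 0
Var-single k G = trans (Var-b₊∷ k [] G) (Var-[] (consΔ k G))

VarAppend : Word → Functional → Functional
VarAppend y G x = Var y (λ w′ → G (shift x ℕ.+ shift w′ ∷ body x ++ body w′))

Var-++ : ∀ x y G → Var (x ++ y) G ≡ Var x (VarAppend y G)
Var-++ [] y G = trans (Var-cong y (λ _ _ → refl)) (sym (Var-[] (VarAppend y G)))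
Var-++ (zero ∷ x) y G = begin
  Var (0 ∷ x ++ y) G                          ≡⟨ Var-b₀∷ (x ++ y) G ⟩
  Var (x ++ y) (G ∘ insertAt 1 0)             ≡⟨ Var-++ x y (G ∘ insertAt 1 0) ⟩
  Var x (VarAppend y (G ∘ insertAt 1 0))      ≡⟨ Var-cong x (λ _ _ → refl) ⟩
  Var x (VarAppend y G ∘ insertAt 1 0)        ≡⟨ sym (Var-b₀∷ x (VarAppend y G)) ⟩
  Var (0 ∷ x) (VarAppend y G)                 ∎
Var-++ (suc k ∷ x) y G = begin
  Var (suc k ∷ x ++ y) G                      ≡⟨ Var-b₊∷ k (x ++ y) G ⟩
  Var (x ++ y) (consΔ k G)                    ≡⟨ Var-++ x y (consΔ k G) ⟩
  Var x (VarAppend y (consΔ k G))             ≡⟨ Var-cong x Δ-inside ⟩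
  Var x (consΔ k (VarAppend y G))             ≡⟨ sym (Var-b₊∷ k x (VarAppend y G)) ⟩
  Var (suc k ∷ x) (VarAppend y G)             ∎
  where
  Δ-inside : ∀ s v → VarAppend y (consΔ k G) (s ∷ v) ≡ consΔ k (VarAppend y G) (s ∷ v)
  Δ-inside s v = begin
    Var y (λ w′ → Δ k (λ s′ m → G (s′ ∷ m ∷ v ++ body w′)) (s ℕ.+ shift w′))
      ≡⟨ Var-cong y (λ t u → sym (Δ-shift k (λ s′ m → G (s′ ∷ m ∷ v ++ u)) t s)) ⟩
    Var y (λ w′ → Δ k (λ s′ m → G (s′ ℕ.+ shift w′ ∷ m ∷ v ++ body w′)) s)
      ≡⟨ sym (Δ-ev k (λ s′ m w′ → G (s′ ℕ.+ shift w′ ∷ m ∷ v ++ body w′)) (variantPoly y) s) ⟩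
    consΔ k (VarAppend y G) (s ∷ v) ∎

Var-pascal₁ : ∀ k v F → Var (suc (suc k) ∷ v) F ≡ Var (suc k ∷ v) (F ∘ bumpAt 1) - Var (suc k ∷ v) (F ∘ bumpAt 0)
Var-pascal₁ k v F = begin
  Var (suc (suc k) ∷ v) F                                   ≡⟨ Var-b₊∷ (suc k) v F ⟩
  Var v (consΔ (suc k) F)                                   ≡⟨ Var-cong v (λ _ _ → refl) ⟩
  Var v (λ x → consΔ k (F ∘ bumpAt 1) x - consΔ k (F ∘ bumpAt 0) x)
    ≡⟨ ev-- (consΔ k (F ∘ bumpAt 1)) (consΔ k (F ∘ bumpAt 0)) (variantPoly v) ⟩
  Var v (consΔ k (F ∘ bumpAt 1)) - Var v (consΔ k (F ∘ bumpAt 0))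
    ≡⟨ sym (cong₂ _-_ (Var-b₊∷ k v (F ∘ bumpAt 1)) (Var-b₊∷ k v (F ∘ bumpAt 0))) ⟩
  Var (suc k ∷ v) (F ∘ bumpAt 1) - Var (suc k ∷ v) (F ∘ bumpAt 0) ∎

Var-pascal₂ : ∀ s m v F → Var (suc s ∷ suc (suc m) ∷ v) F
                           ≡ Var (suc s ∷ suc m ∷ v) (F ∘ bumpAt 2) - Var (suc s ∷ suc m ∷ v) (F ∘ bumpAt 0)
Var-pascal₂ s m v F = begin
  Var (suc s ∷ suc (suc m) ∷ v) F                                         ≡⟨ Var-b₊∷ s (suc (suc m) ∷ v) F ⟩
  Var (suc (suc m) ∷ v) (consΔ s F)                                       ≡⟨ Var-pascal₁ m v (consΔ s F) ⟩
  Var (suc m ∷ v) (consΔ s F ∘ bumpAt 1) - Var (suc m ∷ v) (consΔ s F ∘ bumpAt 0)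
    ≡⟨ cong₂ _-_ (Var-cong (suc m ∷ v) bump₁) (Var-cong (suc m ∷ v) bump₀) ⟩
  Var (suc m ∷ v) (consΔ s (F ∘ bumpAt 2)) - Var (suc m ∷ v) (consΔ s (F ∘ bumpAt 0))
    ≡⟨ sym (cong₂ _-_ (Var-b₊∷ s (suc m ∷ v) (F ∘ bumpAt 2)) (Var-b₊∷ s (suc m ∷ v) (F ∘ bumpAt 0))) ⟩
  Var (suc s ∷ suc m ∷ v) (F ∘ bumpAt 2) - Var (suc s ∷ suc m ∷ v) (F ∘ bumpAt 0) ∎
  where
  bump₁ : ∀ a u → consΔ s F (bumpAt 1 (a ∷ u)) ≡ consΔ s (F ∘ bumpAt 2) (a ∷ u)
  bump₁ a []      = refl
  bump₁ a (b ∷ u) = refl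
  bump₀ : ∀ a u → consΔ s F (bumpAt 0 (a ∷ u)) ≡ consΔ s (F ∘ bumpAt 0) (a ∷ u)
  bump₀ a u = sym (Δ-suc s (λ s′ m′ → F (s′ ∷ m′ ∷ u)) a)

Var-b₊∷-cong : ∀ k a {G G′} → (∀ s m v → G (s ∷ suc m ∷ v) ≡ G′ (s ∷ suc m ∷ v)) →
               Var (suc k ∷ a) G ≡ Var (suc k ∷ a) G′
Var-b₊∷-cong k a {G} {G′} G≗G′ = begin
  Var (suc k ∷ a) G    ≡⟨ Var-b₊∷ k a G ⟩
  Var a (consΔ k G)    ≡⟨ Var-cong a (λ s v → Δ-cong k s (λ s′ m → G≗G′ s′ m v)) ⟩
  Var a (consΔ k G′)   ≡⟨ sym (Var-b₊∷ k a G′) ⟩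
  Var (suc k ∷ a) G′   ∎

overVariants atIdentity : Functional → Functional
overVariants F w = Var (suc (shift w) ∷ body w) F
atIdentity   F w = F (0 ∷ suc (shift w) ∷ body w)

-- Read as for Δ, Var w pairs with ∏ (y_i - x)^(k_i - 1) over the letters b_(k_i) of w. This depends only on
-- the differences y_i - x, so re-expanding b_(1+s) v into its own variants, for each variant (s , v) of a,
-- changes nothing.
Var-overVariants : ∀ a F → Var a (overVariants F) ≡ Var a (atIdentity F)
Var-overVariants [] F =
  trans (Var-[] (overVariants F)) (trans (Var-single 0 F) (sym (Var-[] (atIdentity F))))
Var-overVariants (zero ∷ a) F = begin
  Var (0 ∷ a) (overVariants F)                ≡⟨ Var-b₀∷ a (overVariants F) ⟩
  Var a (overVariants F ∘ insertAt 1 0)       ≡⟨ Var-cong a b₀-inside ⟩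
  Var a (overVariants (F ∘ insertAt 2 0))     ≡⟨ Var-overVariants a (F ∘ insertAt 2 0) ⟩
  Var a (atIdentity (F ∘ insertAt 2 0))       ≡⟨ Var-cong a (λ _ _ → refl) ⟩
  Var a (atIdentity F ∘ insertAt 1 0)         ≡⟨ sym (Var-b₀∷ a (atIdentity F)) ⟩
  Var (0 ∷ a) (atIdentity F)                  ∎
  where
  b₀-inside : ∀ s v → overVariants F (s ∷ 0 ∷ v) ≡ overVariants (F ∘ insertAt 2 0) (s ∷ v)
  b₀-inside s v = begin
    Var (suc s ∷ 0 ∷ v) F                   ≡⟨ Var-b₊∷ s (0 ∷ v) F ⟩
    Var (0 ∷ v) (consΔ s F)                 ≡⟨ Var-b₀∷ v (consΔ s F) ⟩
    Var v (consΔ s F ∘ insertAt 1 0)        ≡⟨ Var-cong v (λ _ _ → refl) ⟩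
    Var v (consΔ s (F ∘ insertAt 2 0))      ≡⟨ sym (Var-b₊∷ s v (F ∘ insertAt 2 0)) ⟩
    Var (suc s ∷ v) (F ∘ insertAt 2 0)      ∎
Var-overVariants (suc k ∷ a) = by-first-letter k
  where
  by-first-letter : ∀ k F → Var (suc k ∷ a) (overVariants F) ≡ Var (suc k ∷ a) (atIdentity F)
  by-first-letter zero F = begin
    Var (1 ∷ a) (overVariants F)                ≡⟨ Var-b₊∷ 0 a (overVariants F) ⟩
    Var a (consΔ 0 (overVariants F))            ≡⟨ Var-cong a b₁-inside ⟩
    Var a (overVariants (F ∘ insertAt 2 1))     ≡⟨ Var-overVariants a (F ∘ insertAt 2 1) ⟩
    Var a (atIdentity (F ∘ insertAt 2 1))       ≡⟨ Var-cong a (λ _ _ → refl) ⟩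
    Var a (consΔ 0 (atIdentity F))              ≡⟨ sym (Var-b₊∷ 0 a (atIdentity F)) ⟩
    Var (1 ∷ a) (atIdentity F)                  ∎
    where
    b₁-inside : ∀ s v → consΔ 0 (overVariants F) (s ∷ v) ≡ overVariants (F ∘ insertAt 2 1) (s ∷ v)
    b₁-inside s v = begin
      Var (suc s ∷ 1 ∷ v) F                 ≡⟨ Var-b₊∷ s (1 ∷ v) F ⟩
      Var (1 ∷ v) (consΔ s F)               ≡⟨ Var-b₊∷ 0 v (consΔ s F) ⟩
      Var v (consΔ 0 (consΔ s F))           ≡⟨ Var-cong v (λ _ _ → refl) ⟩
      Var v (consΔ s (F ∘ insertAt 2 1))    ≡⟨ sym (Var-b₊∷ s v (F ∘ insertAt 2 1)) ⟩
      Var (suc s ∷ v) (F ∘ insertAt 2 1)    ∎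
  by-first-letter (suc k) F = begin
    Var (suc (suc k) ∷ a) (overVariants F)
      ≡⟨ Var-pascal₁ k a (overVariants F) ⟩
    Var (suc k ∷ a) (overVariants F ∘ bumpAt 1) - Var (suc k ∷ a) (overVariants F ∘ bumpAt 0)
      ≡⟨ cong₂ _-_ (trans (Var-b₊∷-cong k a (λ s m v → Var-pascal₂ s m v F)) (ev-- _ _ P))
                   (trans (Var-cong (suc k ∷ a) (λ s v → Var-pascal₁ s v F)) (ev-- _ _ P)) ⟩
    (Var (suc k ∷ a) (overVariants F₂) - Var (suc k ∷ a) (overVariants F₀))
      - (Var (suc k ∷ a) (overVariants F₁) - Var (suc k ∷ a) (overVariants F₀))
      ≡⟨ solve 3 (λ x z y → (x :- z) :- (y :- z) := x :- y) refl
           (Var (suc k ∷ a) (overVariants F₂)) (Var (suc k ∷ a) (overVariants F₀)) (Var (suc k ∷ a) (overVariants F₁)) ⟩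
    Var (suc k ∷ a) (overVariants F₂) - Var (suc k ∷ a) (overVariants F₁)
      ≡⟨ cong₂ _-_ (by-first-letter k F₂) (by-first-letter k F₁) ⟩
    Var (suc k ∷ a) (atIdentity F₂) - Var (suc k ∷ a) (atIdentity F₁)
      ≡⟨ cong₂ _-_ (Var-cong (suc k ∷ a) bump₂) (Var-cong (suc k ∷ a) (λ _ _ → refl)) ⟩
    Var (suc k ∷ a) (atIdentity F ∘ bumpAt 1) - Var (suc k ∷ a) (atIdentity F ∘ bumpAt 0)
      ≡⟨ sym (Var-pascal₁ k a (atIdentity F)) ⟩
    Var (suc (suc k) ∷ a) (atIdentity F) ∎
    where
    P = variantPoly (suc k ∷ a)
    F₀ F₁ F₂ : Functional
    F₀ = F ∘ bumpAt 0
    F₁ = F ∘ bumpAt 1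
    F₂ = F ∘ bumpAt 2
    bump₂ : ∀ s v → atIdentity F₂ (s ∷ v) ≡ atIdentity F (bumpAt 1 (s ∷ v))
    bump₂ s []      = refl
    bump₂ s (m ∷ v) = refl

Var-overVariants-Δ : ∀ k F a → Var a (λ w → Var (suc k ℕ.+ shift w ∷ body w) F)
                               ≡ Var a (λ w → Δ k (λ s m → F (s ∷ m ℕ.+ shift w ∷ body w)) 0)
Var-overVariants-Δ zero F a = Var-overVariants a F
Var-overVariants-Δ (suc k) F a = begin
  Var a (λ w → Var (suc (suc k) ℕ.+ shift w ∷ body w) F)
    ≡⟨ Var-cong a (λ s v → Var-pascal₁ (k ℕ.+ s) v F) ⟩
  Var a (λ w → Var (suc k ℕ.+ shift w ∷ body w) (F ∘ bumpAt 1) - Var (suc k ℕ.+ shift w ∷ body w) (F ∘ bumpAt 0))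
    ≡⟨ ev-- _ _ (variantPoly a) ⟩
  Var a (λ w → Var (suc k ℕ.+ shift w ∷ body w) (F ∘ bumpAt 1))
    - Var a (λ w → Var (suc k ℕ.+ shift w ∷ body w) (F ∘ bumpAt 0))
    ≡⟨ cong₂ _-_ (Var-overVariants-Δ k (F ∘ bumpAt 1) a) (Var-overVariants-Δ k (F ∘ bumpAt 0) a) ⟩
  Var a (λ w → Δ k (λ s m → F (bumpAt 1 (s ∷ m ℕ.+ shift w ∷ body w))) 0)
    - Var a (λ w → Δ k (λ s m → F (bumpAt 0 (s ∷ m ℕ.+ shift w ∷ body w))) 0)
    ≡⟨ sym (ev-- _ _ (variantPoly a)) ⟩
  Var a (λ w → Δ (suc k) (λ s m → F (s ∷ m ℕ.+ shift w ∷ body w)) 0) ∎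

rotate : Word → Word
rotate (s ∷ m ∷ v) = s ∷ v ∷ʳ m
rotate w           = w

Var-∷ʳ : ∀ k y F → Var (y ∷ʳ suc k) F ≡ Var (suc k ∷ y) (F ∘ rotate)
Var-∷ʳ k y F = begin
  Var (y ++ suc k ∷ []) F
    ≡⟨ Var-++ y (suc k ∷ []) F ⟩
  Var y (λ w → Var (suc k ∷ []) (λ w′ → F (shift w ℕ.+ shift w′ ∷ body w ++ body w′)))
    ≡⟨ Var-cong y (λ s v → Var-single k (λ w′ → F (s ℕ.+ shift w′ ∷ v ++ body w′))) ⟩
  Var y (λ w → Δ k (λ t m → F (shift w ℕ.+ t ∷ body w ∷ʳ m)) 0)
    ≡⟨ Var-cong y (λ s v → Δ-cong k 0 (λ t m → cong (λ z → F (z ∷ v ∷ʳ suc m)) (ℕP.+-comm s t))) ⟩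
  Var y (λ w → Δ k (λ t m → F (t ℕ.+ shift w ∷ body w ∷ʳ m)) 0)
    ≡⟨ sym (Δ-ev k (λ t m w → F (t ℕ.+ shift w ∷ body w ∷ʳ m)) (variantPoly y) 0) ⟩
  Δ k (λ t m → Var y (λ w → F (rotate (t ℕ.+ shift w ∷ m ∷ body w)))) 0
    ≡⟨ sym (Var-single k (λ w′ → Var y (λ w → F (rotate (shift w′ ℕ.+ shift w ∷ body w′ ++ body w))))) ⟩
  Var (suc k ∷ []) (λ w′ → Var y (λ w → F (rotate (shift w′ ℕ.+ shift w ∷ body w′ ++ body w))))
    ≡⟨ sym (Var-++ (suc k ∷ []) y (F ∘ rotate)) ⟩
  Var (suc k ∷ y) (F ∘ rotate) ∎

-- Transposed derivations

∂* : Word → Functional → Functional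
∂* w h u = ev h (∂word w u)

∂*letter : Word → Functional → ℕ → ℚ
∂*letter w h i = ev h (∂letter w i)

∂*-∷ : ∀ w h i u → ∂* w h (i ∷ u) ≡ ∂*letter w (λ x → h (x ++ u)) i + ∂* w (λ y → h (i ∷ y)) u
∂*-∷ w h i u = begin
  ev h (∂letter w i ⊛ word u ⊕ letter i ⊛ ∂word w u)
    ≡⟨ ev-++ h (∂letter w i ⊛ word u) (letter i ⊛ ∂word w u) ⟩
  ev h (∂letter w i ⊛ word u) + ev h (letter i ⊛ ∂word w u)
    ≡⟨ cong₂ _+_ (trans (ev-⊛ h (∂letter w i) (word u))
                        (ev-cong (∂letter w i) (λ x → ev-word (λ v → h (x ++ v)) u)))
                 (trans (ev-⊛ h (letter i) (∂word w u))
                        (ev-word (λ x → ev (λ v → h (x ++ v)) (∂word w u)) (i ∷ []))) ⟩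
  ∂*letter w (λ x → h (x ++ u)) i + ∂* w (λ y → h (i ∷ y)) u ∎

∂*-single : ∀ w h i → ∂* w h (i ∷ []) ≡ ∂*letter w h i
∂*-single w h i =
  trans (∂*-∷ w h i []) (trans (ℚP.+-identityʳ _) (ev-cong (∂letter w i) (λ x → cong h (ListP.++-identityʳ x))))

∂*-++ : ∀ w h x y → ∂* w h (x ++ y) ≡ ∂* w (λ z → h (z ++ y)) x + ∂* w (λ z → h (x ++ z)) y
∂*-++ w h [] y = sym (ℚP.+-identityˡ (∂* w h y))
∂*-++ w h (i ∷ x) y = begin
  ∂* w h (i ∷ x ++ y)
    ≡⟨ ∂*-∷ w h i (x ++ y) ⟩
  ∂*letter w (λ z → h (z ++ x ++ y)) i + ∂* w (λ z → h (i ∷ z)) (x ++ y)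
    ≡⟨ cong₂ _+_ (ev-cong (∂letter w i) (λ z → cong h (sym (ListP.++-assoc z x y))))
                 (∂*-++ w (λ z → h (i ∷ z)) x y) ⟩
  ∂*letter w (λ z → h ((z ++ x) ++ y)) i + (∂* w (λ z → h (i ∷ z ++ y)) x + ∂* w (λ z → h (i ∷ x ++ z)) y)
    ≡⟨ sym (ℚP.+-assoc (∂*letter w (λ z → h ((z ++ x) ++ y)) i) (∂* w (λ z → h (i ∷ z ++ y)) x)
                       (∂* w (λ z → h (i ∷ x ++ z)) y)) ⟩
  (∂*letter w (λ z → h ((z ++ x) ++ y)) i + ∂* w (λ z → h (i ∷ z ++ y)) x) + ∂* w (λ z → h (i ∷ x ++ z)) y
    ≡⟨ cong (_+ ∂* w (λ z → h (i ∷ x ++ z)) y) (sym (∂*-∷ w (λ z → h (z ++ y)) i x)) ⟩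
  ∂* w (λ z → h (z ++ y)) (i ∷ x) + ∂* w (λ z → h (i ∷ x ++ z)) y ∎

evBracket : Functional → ℕ → Word → ℚ
evBracket g n v = g (n ∷ v) - g (v ∷ʳ n)

ev-⟦letter,word⟧ : ∀ g n v → ev g ⟦ letter n , word v ⟧ ≡ evBracket g n v
ev-⟦letter,word⟧ g n v = trans (ev-⊖ g (letter n ⊛ word v) (word v ⊛ letter n)) (cong₂ _-_ nv vn)
  where
  nv : ev g (letter n ⊛ word v) ≡ g (n ∷ v)
  nv = trans (ev-⊛ g (letter n) (word v))
             (trans (ev-word (λ x → ev (λ y → g (x ++ y)) (word v)) (n ∷ [])) (ev-word (λ y → g (n ∷ y)) v))
  vn : ev g (word v ⊛ letter n) ≡ g (v ∷ʳ n)
  vn = trans (ev-⊛ g (word v) (letter n))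
             (trans (ev-word (λ x → ev (λ y → g (x ++ y)) (letter n)) v) (ev-word (λ y → g (v ++ y)) (n ∷ [])))

ev-sumP-brackets : ∀ g n (F : Triple → Poly) → (∀ c s v → F (c , s , v) ≡ c · ⟦ letter (n ℕ.+ s) , word v ⟧) →
                   ∀ xs → ev g (sumP (map F xs)) ≡ ev (λ x → evBracket g (n ℕ.+ shift x) (body x)) (map encode xs)
ev-sumP-brackets g n F F-def [] = refl
ev-sumP-brackets g n F F-def ((c , s , v) ∷ xs) = begin
  ev g (F (c , s , v) ⊕ sumP (map F xs))
    ≡⟨ ev-++ g (F (c , s , v)) (sumP (map F xs)) ⟩
  ev g (F (c , s , v)) + ev g (sumP (map F xs))
    ≡⟨ cong₂ _+_ (trans (cong (ev g) (F-def c s v))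
                        (trans (ev-· g c ⟦ letter (n ℕ.+ s) , word v ⟧) (cong (c *_) (ev-⟦letter,word⟧ g (n ℕ.+ s) v))))
                 (ev-sumP-brackets g n F F-def xs) ⟩
  c * evBracket g (n ℕ.+ s) v + ev (λ x → evBracket g (n ℕ.+ shift x) (body x)) (map encode xs) ∎

variants-b₀^ : ∀ m → variants (replicate m 0) ≡ (1ℚ , 0 , replicate m 0) ∷ []
variants-b₀^ zero = refl
variants-b₀^ (suc m) rewrite variants-b₀^ m = refl

-- The special cases w = b₀^(m+1) and w = 1 of ∂letter agree with the general formula.
∂*letter-suc : ∀ w g i → ∂*letter w g (suc i) ≡ Var w (λ x → evBracket g (suc i ℕ.+ shift x) (body x))
∂*letter-suc w g i with shape w
... | nonzero _ = ev-sumP-brackets g (suc i) _ (λ _ _ _ → refl) (variants w)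
... | pureB0 m = begin
  ev g ⟦ letter (suc i) , word (replicate (suc m) 0) ⟧
    ≡⟨ ev-⟦letter,word⟧ g (suc i) (replicate (suc m) 0) ⟩
  evBracket g (suc i) (replicate (suc m) 0)
    ≡⟨ cong (λ n → evBracket g n (replicate (suc m) 0)) (sym (ℕP.+-identityʳ (suc i))) ⟩
  evBracket g (suc i ℕ.+ 0) (replicate (suc m) 0)
    ≡⟨ sym (ev-word (λ x → evBracket g (suc i ℕ.+ shift x) (body x)) (0 ∷ replicate (suc m) 0)) ⟩
  ev (λ x → evBracket g (suc i ℕ.+ shift x) (body x)) (map encode ((1ℚ , 0 , replicate (suc m) 0) ∷ []))
    ≡⟨ cong (λ xs → ev (λ x → evBracket g (suc i ℕ.+ shift x) (body x)) (map encode xs))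
            (sym (variants-b₀^ (suc m))) ⟩
  Var (replicate (suc m) 0) (λ x → evBracket g (suc i ℕ.+ shift x) (body x)) ∎
... | empty =
  sym (trans (ev-word (λ x → evBracket g (suc i ℕ.+ shift x) (body x)) (0 ∷ [])) (ℚP.+-inverseʳ (g (suc i ℕ.+ 0 ∷ []))))

evBracket-Var-++ : ∀ b G n v → evBracket (λ x → Var (x ++ b) G) (suc n) v
                               ≡ Var (suc n ∷ v) (λ x → VarAppend b G x - VarAppend b G (rotate x))
evBracket-Var-++ b G n v = begin
  Var (suc n ∷ v ++ b) G - Var ((v ∷ʳ suc n) ++ b) G
    ≡⟨ cong₂ _-_ (Var-++ (suc n ∷ v) b G) (trans (Var-++ (v ∷ʳ suc n) b G) (Var-∷ʳ n v (VarAppend b G))) ⟩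
  Var (suc n ∷ v) (VarAppend b G) - Var (suc n ∷ v) (VarAppend b G ∘ rotate)
    ≡⟨ sym (ev-- (VarAppend b G) (VarAppend b G ∘ rotate) (variantPoly (suc n ∷ v))) ⟩
  Var (suc n ∷ v) (λ x → VarAppend b G x - VarAppend b G (rotate x)) ∎

∂*letter-Var-++ : ∀ a b G k → ∂*letter a (λ x → Var (x ++ b) G) (suc k)
                             ≡ Var b (λ w → Δ k (λ s m → ∂*letter a (λ x → G (s ∷ x ++ body w)) m) (shift w))
∂*letter-Var-++ a b G k = begin
  ∂*letter a (λ x → Var (x ++ b) G) (suc k)
    ≡⟨ ∂*letter-suc a (λ x → Var (x ++ b) G) k ⟩
  Var a (λ w → evBracket (λ x → Var (x ++ b) G) (suc k ℕ.+ shift w) (body w))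
    ≡⟨ Var-cong a (λ s v → evBracket-Var-++ b G (k ℕ.+ s) v) ⟩
  Var a (λ w → Var (suc k ℕ.+ shift w ∷ body w) H)
    ≡⟨ Var-overVariants-Δ k H a ⟩
  Var a (λ w → Δ k (λ s m → H (s ∷ m ℕ.+ shift w ∷ body w)) 0)
    ≡⟨ Var-cong a H-inside ⟩
  Var a (λ w → Var b (λ w′ → Δ k (X w w′) 0))
    ≡⟨ ev-swap (λ w w′ → Δ k (X w w′) 0) (variantPoly a) (variantPoly b) ⟩
  Var b (λ w′ → Var a (λ w → Δ k (X w w′) 0))
    ≡⟨ Var-cong b (λ t u → Var-cong a (λ s v → Δ-shift k (Y (s ∷ v) (t ∷ u)) t 0)) ⟩
  Var b (λ w′ → Var a (λ w → Δ k (Y w w′) (shift w′)))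
    ≡⟨ Var-cong b (λ t u → sym (Δ-ev k (λ h m w → Y w (t ∷ u) h m) (variantPoly a) t)) ⟩
  Var b (λ w′ → Δ k (λ h m → Var a (λ w → Y w w′ h m)) (shift w′))
    ≡⟨ Var-cong b (λ t u → Δ-cong k t (λ h m → sym (∂*letter-suc a (λ x → G (h ∷ x ++ u)) m))) ⟩
  Var b (λ w → Δ k (λ s m → ∂*letter a (λ x → G (s ∷ x ++ body w)) m) (shift w)) ∎
  where
  H : Functional
  H x = VarAppend b G x - VarAppend b G (rotate x)
  Y : Word → Word → ℕ → ℕ → ℚ
  Y w w′ h m = evBracket (λ x → G (h ∷ x ++ body w′)) (m ℕ.+ shift w) (body w)
  X : Word → Word → ℕ → ℕ → ℚ
  X w w′ h m = Y w w′ (h ℕ.+ shift w′) m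
  H-inside : ∀ s v → Δ k (λ h m → H (h ∷ m ℕ.+ s ∷ v)) 0 ≡ Var b (λ w′ → Δ k (X (s ∷ v) w′) 0)
  H-inside s v = trans (Δ-cong k 0 (λ h m → sym (ev-- _ _ (variantPoly b))))
                       (Δ-ev k (λ h m w′ → X (s ∷ v) w′ h m) (variantPoly b) 0)

∂*body : Word → Functional → Functional
∂*body a G x = ∂* a (λ y → G (shift x ∷ y)) (body x)

-- ∂_a commutes with passing to variants, acting on their bodies only.
∂*-Var : ∀ a b G → ∂* a (λ w → Var w G) b ≡ Var b (∂*body a G)
∂*-Var a [] G = sym (Var-[] (∂*body a G))
∂*-Var a (zero ∷ b) G = begin
  ∂* a (λ w → Var w G) (0 ∷ b)              ≡⟨ ∂*-∷ a (λ w → Var w G) 0 b ⟩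
  0ℚ + ∂* a (λ y → Var (0 ∷ y) G) b         ≡⟨ ℚP.+-identityˡ _ ⟩
  ∂* a (λ y → Var (0 ∷ y) G) b              ≡⟨ ev-cong (∂word a b) (λ y → Var-b₀∷ y G) ⟩
  ∂* a (λ y → Var y (G ∘ insertAt 1 0)) b   ≡⟨ ∂*-Var a b (G ∘ insertAt 1 0) ⟩
  Var b (∂*body a (G ∘ insertAt 1 0))       ≡⟨ Var-cong b b₀-inside ⟩
  Var b (∂*body a G ∘ insertAt 1 0)         ≡⟨ sym (Var-b₀∷ b (∂*body a G)) ⟩
  Var (0 ∷ b) (∂*body a G)                  ∎
  where
  b₀-inside : ∀ s v → ∂*body a (G ∘ insertAt 1 0) (s ∷ v) ≡ ∂*body a G (s ∷ 0 ∷ v)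
  b₀-inside s v = sym (trans (∂*-∷ a (λ y → G (s ∷ y)) 0 v) (ℚP.+-identityˡ _))
∂*-Var a (suc k ∷ b) G = begin
  ∂* a (λ w → Var w G) (suc k ∷ b)
    ≡⟨ ∂*-∷ a (λ w → Var w G) (suc k) b ⟩
  ∂*letter a (λ x → Var (x ++ b) G) (suc k) + ∂* a (λ y → Var (suc k ∷ y) G) b
    ≡⟨ cong₂ _+_ (∂*letter-Var-++ a b G k)
                 (trans (ev-cong (∂word a b) (λ y → Var-b₊∷ k y G)) (∂*-Var a b (consΔ k G))) ⟩
  Var b P + Var b (∂*body a (consΔ k G))
    ≡⟨ sym (ev-+ P (∂*body a (consΔ k G)) (variantPoly b)) ⟩
  Var b (λ w → P w + ∂*body a (consΔ k G) w)
    ≡⟨ Var-cong b (λ s v → sym (consΔ-∂*body s v)) ⟩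
  Var b (consΔ k (∂*body a G))
    ≡⟨ sym (Var-b₊∷ k b (∂*body a G)) ⟩
  Var (suc k ∷ b) (∂*body a G) ∎
  where
  P : Functional
  P w = Δ k (λ s m → ∂*letter a (λ x → G (s ∷ x ++ body w)) m) (shift w)
  consΔ-∂*body : ∀ s v → consΔ k (∂*body a G) (s ∷ v) ≡ P (s ∷ v) + ∂*body a (consΔ k G) (s ∷ v)
  consΔ-∂*body s v = begin
    Δ k (λ s′ m → ∂* a (λ y → G (s′ ∷ y)) (m ∷ v)) s
      ≡⟨ Δ-cong k s (λ s′ m → ∂*-∷ a (λ y → G (s′ ∷ y)) (suc m) v) ⟩
    Δ k (λ s′ m → ∂*letter a (λ x → G (s′ ∷ x ++ v)) m + ∂* a (λ y → G (s′ ∷ m ∷ y)) v) s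
      ≡⟨ Δ-+ k (λ s′ m → ∂*letter a (λ x → G (s′ ∷ x ++ v)) m) (λ s′ m → ∂* a (λ y → G (s′ ∷ m ∷ y)) v)
             s ⟩
    P (s ∷ v) + Δ k (λ s′ m → ∂* a (λ y → G (s′ ∷ m ∷ y)) v) s
      ≡⟨ cong (P (s ∷ v) +_) (Δ-ev k (λ s′ m y → G (s′ ∷ m ∷ y)) (∂word a v) s) ⟩
    P (s ∷ v) + ∂*body a (consΔ k G) (s ∷ v) ∎

-- Commutators of derivations

evBracket₂ : Functional → ℕ → Word → Word → ℚ
evBracket₂ g p x v = evBracket (λ z → g (z ++ v) - g (v ++ z)) p x

evBracket₂-jacobi : ∀ g p x v → evBracket₂ g p x v - evBracket₂ g p v x
                                 ≡ evBracket g p (x ++ v) - evBracket g p (v ++ x)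
evBracket₂-jacobi g p x v
  rewrite ListP.++-assoc x (p ∷ []) v | ListP.++-assoc v (p ∷ []) x
        | sym (ListP.++-assoc v x (p ∷ [])) | sym (ListP.++-assoc x v (p ∷ [])) =
  solve 6 (λ a b c e a′ e′ → ((a :- b) :- (c :- e)) :- ((a′ :- c) :- (b :- e′)) := (a :- e′) :- (a′ :- e)) refl
    (g (p ∷ x ++ v)) (g (v ++ p ∷ x)) (g (x ++ p ∷ v)) (g ((v ++ x) ∷ʳ p)) (g (p ∷ v ++ x)) (g ((x ++ v) ∷ʳ p))

evBracket-∂* : ∀ a g m v → evBracket (∂* a g) (suc m) v
                          ≡ Var a (λ w → evBracket₂ g (suc m ℕ.+ shift w) (body w) v) + ∂* a (evBracket g (suc m)) v
evBracket-∂* a g m v = begin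
  ∂* a g (suc m ∷ v) - ∂* a g (v ∷ʳ suc m)
    ≡⟨ cong₂ _-_ (∂*-∷ a g (suc m) v)
                 (trans (∂*-++ a g v (suc m ∷ [])) (cong (D₂ +_) (∂*-single a (λ z → g (v ++ z)) (suc m)))) ⟩
  (L₁ + D₁) - (D₂ + L₂)
    ≡⟨ solve 4 (λ l₁ d₁ d₂ l₂ → (l₁ :+ d₁) :- (d₂ :+ l₂) := (l₁ :- l₂) :+ (d₁ :- d₂))
             refl L₁ D₁ D₂ L₂ ⟩
  (L₁ - L₂) + (D₁ - D₂)
    ≡⟨ cong₂ _+_ (trans (sym (ev-- (λ z → g (z ++ v)) (λ z → g (v ++ z)) (∂letter a (suc m))))
                        (∂*letter-suc a (λ z → g (z ++ v) - g (v ++ z)) m))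
                 (sym (ev-- (λ y → g (suc m ∷ y)) (λ z → g (z ∷ʳ suc m)) (∂word a v))) ⟩
  Var a (λ w → evBracket₂ g (suc m ℕ.+ shift w) (body w) v) + ∂* a (evBracket g (suc m)) v ∎
  where
  L₁ = ∂*letter a (λ z → g (z ++ v)) (suc m)
  L₂ = ∂*letter a (λ z → g (v ++ z)) (suc m)
  D₁ = ∂* a (λ y → g (suc m ∷ y)) v
  D₂ = ∂* a (λ z → g (z ∷ʳ suc m)) v

nestedBrackets : Functional → ℕ → Word → Word → ℚ
nestedBrackets g n a b =
  Var b (λ w → Var a (λ w₂ → evBracket₂ g (n ℕ.+ shift w ℕ.+ shift w₂) (body w₂) (body w)))

∂*letter-∂* : ∀ a b g i → ∂*letter b (∂* a g) (suc i)
                         ≡ nestedBrackets g (suc i) a b + ∂* a (λ w → ∂*letter w g (suc i)) b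
∂*letter-∂* a b g i = begin
  ∂*letter b (∂* a g) (suc i)
    ≡⟨ ∂*letter-suc b (∂* a g) i ⟩
  Var b (λ w → evBracket (∂* a g) (suc i ℕ.+ shift w) (body w))
    ≡⟨ Var-cong b (λ s v → evBracket-∂* a g (i ℕ.+ s) v) ⟩
  Var b (λ w → Var a (λ w₂ → evBracket₂ g (suc i ℕ.+ shift w ℕ.+ shift w₂) (body w₂) (body w)) + ∂*body a G w)
    ≡⟨ ev-+ _ (∂*body a G) (variantPoly b) ⟩
  nestedBrackets g (suc i) a b + Var b (∂*body a G)
    ≡⟨ cong (nestedBrackets g (suc i) a b +_)
            (trans (sym (∂*-Var a b G)) (ev-cong (∂word a b) (λ w → sym (∂*letter-suc w g i)))) ⟩
  nestedBrackets g (suc i) a b + ∂* a (λ w → ∂*letter w g (suc i)) b ∎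
  where
  G : Functional
  G w = evBracket g (suc i ℕ.+ shift w) (body w)

∂*letter-++ : ∀ a b g i →
              ∂*letter (a ++ b) g (suc i)
              ≡ Var a (λ w → Var b (λ w′ → evBracket g (suc i ℕ.+ (shift w ℕ.+ shift w′)) (body w ++ body w′)))
∂*letter-++ a b g i = trans (∂*letter-suc (a ++ b) g i) (Var-++ a b _)

nestedBrackets-antisym : ∀ a b g i → nestedBrackets g (suc i) a b - nestedBrackets g (suc i) b a
                                    ≡ ∂*letter (a ++ b) g (suc i) - ∂*letter (b ++ a) g (suc i)
nestedBrackets-antisym a b g i = begin
  nestedBrackets g n a b - nestedBrackets g n b a
    ≡⟨ cong (λ z → nestedBrackets g n a b - z) (ev-swap _ (variantPoly a) (variantPoly b)) ⟩
  Var b (λ w → Var a (λ w₂ → B w w₂)) - Var b (λ w → Var a (λ w₂ → B′ w w₂))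
    ≡⟨ sym (ev-- _ _ (variantPoly b)) ⟩
  Var b (λ w → Var a (λ w₂ → B w w₂) - Var a (λ w₂ → B′ w w₂))
    ≡⟨ Var-cong b (λ s v → trans (sym (ev-- _ _ (variantPoly a)))
                                 (trans (Var-cong a (λ t x → jacobi s v t x)) (ev-- _ _ (variantPoly a)))) ⟩
  Var b (λ w → Var a (λ w₂ → K w₂ w) - Var a (λ w₂ → K w w₂))
    ≡⟨ ev-- _ _ (variantPoly b) ⟩
  Var b (λ w → Var a (λ w₂ → K w₂ w)) - Var b (λ w → Var a (λ w₂ → K w w₂))
    ≡⟨ cong₂ _-_ (trans (sym (ev-swap K (variantPoly a) (variantPoly b))) (sym (∂*letter-++ a b g i)))
                 (sym (∂*letter-++ b a g i)) ⟩
  ∂*letter (a ++ b) g n - ∂*letter (b ++ a) g n ∎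
  where
  n = suc i
  B B′ K : Word → Word → ℚ
  B  w w₂ = evBracket₂ g (n ℕ.+ shift w ℕ.+ shift w₂) (body w₂) (body w)
  B′ w w₂ = evBracket₂ g (n ℕ.+ shift w₂ ℕ.+ shift w) (body w) (body w₂)
  K  w w₂ = evBracket g (n ℕ.+ (shift w ℕ.+ shift w₂)) (body w ++ body w₂)
  jacobi : ∀ s v t x → B (s ∷ v) (t ∷ x) - B′ (s ∷ v) (t ∷ x) ≡ K (t ∷ x) (s ∷ v) - K (s ∷ v) (t ∷ x)
  jacobi s v t x rewrite ℕP.+-assoc n t s | ℕP.+-comm t s | ℕP.+-assoc n s t =
    evBracket₂-jacobi g (n ℕ.+ (s ℕ.+ t)) x v

evBracketA : Functional → Word → Word → ℚ
evBracketA G a b = (∂* a G b - ∂* b G a) + (G (a ++ b) - G (b ++ a))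

evBracketA-0 : ∀ a b → evBracketA (λ _ → 0ℚ) a b ≡ 0ℚ
evBracketA-0 a b rewrite ev-0 (∂word a b) | ev-0 (∂word b a) = refl

evBracketA-+ : ∀ {G} G₁ G₂ → (∀ w → G w ≡ G₁ w + G₂ w) →
               ∀ a b → evBracketA G a b ≡ evBracketA G₁ a b + evBracketA G₂ a b
evBracketA-+ {G} G₁ G₂ G≗ a b = begin
  (∂* a G b - ∂* b G a) + (G (a ++ b) - G (b ++ a))
    ≡⟨ cong₂ (λ x y → (x - y) + (G (a ++ b) - G (b ++ a)))
             (trans (ev-cong (∂word a b) G≗) (ev-+ G₁ G₂ (∂word a b)))
             (trans (ev-cong (∂word b a) G≗) (ev-+ G₁ G₂ (∂word b a))) ⟩
  ((∂* a G₁ b + ∂* a G₂ b) - (∂* b G₁ a + ∂* b G₂ a)) + (G (a ++ b) - G (b ++ a))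
    ≡⟨ cong₂ (λ x y → ((∂* a G₁ b + ∂* a G₂ b) - (∂* b G₁ a + ∂* b G₂ a)) + (x - y))
             (G≗ (a ++ b)) (G≗ (b ++ a)) ⟩
  ((∂* a G₁ b + ∂* a G₂ b) - (∂* b G₁ a + ∂* b G₂ a))
    + ((G₁ (a ++ b) + G₂ (a ++ b)) - (G₁ (b ++ a) + G₂ (b ++ a)))
    ≡⟨ solve 8 (λ p p′ q q′ r r′ t t′ → ((p :+ p′) :- (q :+ q′)) :+ ((r :+ r′) :- (t :+ t′))
                                       := ((p :- q) :+ (r :- t)) :+ ((p′ :- q′) :+ (r′ :- t′))) refl
         (∂* a G₁ b) (∂* a G₂ b) (∂* b G₁ a) (∂* b G₂ a)
         (G₁ (a ++ b)) (G₂ (a ++ b)) (G₁ (b ++ a)) (G₂ (b ++ a)) ⟩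
  evBracketA G₁ a b + evBracketA G₂ a b ∎

∂*letter-commutator : ∀ a b g i → ∂*letter b (∂* a g) i - ∂*letter a (∂* b g) i
                                   ≡ evBracketA (λ w → ∂*letter w g i) a b
∂*letter-commutator a b g zero = sym (evBracketA-0 a b)
∂*letter-commutator a b g (suc i) = begin
  ∂*letter b (∂* a g) n - ∂*letter a (∂* b g) n
    ≡⟨ cong₂ _-_ (∂*letter-∂* a b g i) (∂*letter-∂* b a g i) ⟩
  (nestedBrackets g n a b + ∂* a G b) - (nestedBrackets g n b a + ∂* b G a)
    ≡⟨ solve 4 (λ x p y q → (x :+ p) :- (y :+ q) := (p :- q) :+ (x :- y)) refl
         (nestedBrackets g n a b) (∂* a G b) (nestedBrackets g n b a) (∂* b G a) ⟩
  (∂* a G b - ∂* b G a) + (nestedBrackets g n a b - nestedBrackets g n b a)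
    ≡⟨ cong ((∂* a G b - ∂* b G a) +_) (nestedBrackets-antisym a b g i) ⟩
  evBracketA G a b ∎
  where
  n = suc i
  G : Functional
  G w = ∂*letter w g n

∂*-commutator : ∀ a b u h → ∂* b (∂* a h) u - ∂* a (∂* b h) u ≡ evBracketA (λ w → ∂* w h u) a b
∂*-commutator a b []      h = sym (evBracketA-0 a b)
∂*-commutator a b (i ∷ u) h = begin
  ∂* b (∂* a h) (i ∷ u) - ∂* a (∂* b h) (i ∷ u)
    ≡⟨ cong₂ _-_ (expand a b) (expand b a) ⟩
  ((L a b + C a b) + (C b a + D a b)) - ((L b a + C b a) + (C a b + D b a))
    ≡⟨ solve 6 (λ l l′ c c′ d d′ → ((l :+ c) :+ (c′ :+ d)) :- ((l′ :+ c′) :+ (c :+ d′))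
                                   := (l :- l′) :+ (d :- d′))
         refl (L a b) (L b a) (C a b) (C b a) (D a b) (D b a) ⟩
  (L a b - L b a) + (D a b - D b a)
    ≡⟨ cong₂ _+_ (∂*letter-commutator a b hᵤ i) (∂*-commutator a b u hᵢ) ⟩
  evBracketA (λ w → ∂*letter w hᵤ i) a b + evBracketA (λ w → ∂* w hᵢ u) a b
    ≡⟨ sym (evBracketA-+ (λ w → ∂*letter w hᵤ i) (λ w → ∂* w hᵢ u) (λ w → ∂*-∷ w h i u) a b) ⟩
  evBracketA (λ w → ∂* w h (i ∷ u)) a b ∎
  where
  hᵤ hᵢ : Functional
  hᵤ z = h (z ++ u)
  hᵢ z = h (i ∷ z)
  L C D : Word → Word → ℚ
  L p q = ∂*letter q (∂* p hᵤ) i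
  C p q = ∂* p (λ y → ∂*letter q (λ x → h (x ++ y)) i) u
  D p q = ∂* q (∂* p hᵢ) u
  -- The cross terms C p q come from ∂_q acting on the letter and ∂_p on the rest, or vice versa; they cancel.
  expand : ∀ p q → ∂* q (∂* p h) (i ∷ u) ≡ (L p q + C p q) + (C q p + D p q)
  expand p q = trans (∂*-∷ q (∂* p h) i u) (cong₂ _+_ letter-part rest-part)
    where
    letter-part : ∂*letter q (λ x → ∂* p h (x ++ u)) i ≡ L p q + C p q
    letter-part = begin
      ∂*letter q (λ x → ∂* p h (x ++ u)) i
        ≡⟨ ev-cong (∂letter q i) (λ x → ∂*-++ p h x u) ⟩
      ev (λ x → ∂* p hᵤ x + ∂* p (λ z → h (x ++ z)) u) (∂letter q i)
        ≡⟨ ev-+ (∂* p hᵤ) (λ x → ∂* p (λ z → h (x ++ z)) u) (∂letter q i) ⟩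
      L p q + ev (λ x → ∂* p (λ z → h (x ++ z)) u) (∂letter q i)
        ≡⟨ cong (L p q +_) (ev-swap (λ x z → h (x ++ z)) (∂letter q i) (∂word p u)) ⟩
      L p q + C p q ∎
    rest-part : ∂* q (λ y → ∂* p h (i ∷ y)) u ≡ C q p + D p q
    rest-part = trans (ev-cong (∂word q u) (λ y → ∂*-∷ p h i y))
                      (ev-+ (λ y → ∂*letter p (λ x → h (x ++ y)) i) (∂* p hᵢ) (∂word q u))

-- The operators σ_ψ

-- Transposition reverses composition: σ* φ (σ* ψ h) is paired with σ ψ (σ φ f).
σ*word : Word → Functional → Functional
σ*word w h u = h (w ++ u) + ∂* w h u

σ*word-∘ : ∀ a b h u → σ*word b (σ*word a h) u
                      ≡ (h (a ++ b ++ u) + (∂* a (λ z → h (z ++ u)) b + ∂* a (λ z → h (b ++ z)) u))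
                        + (∂* b (λ z → h (a ++ z)) u + ∂* b (∂* a h) u)
σ*word-∘ a b h u =
  cong₂ (λ x y → (h (a ++ b ++ u) + x) + y) (∂*-++ a h b u) (ev-+ (λ x → h (a ++ x)) (∂* a h) (∂word b u))

σ*word-commutator : ∀ a b u h → evBracketA (λ w → σ*word w h u) a b
                                 ≡ σ*word b (σ*word a h) u - σ*word a (σ*word b h) u
σ*word-commutator a b u h = begin
  evBracketA (λ w → σ*word w h u) a b
    ≡⟨ evBracketA-+ (λ w → h (w ++ u)) (λ w → ∂* w h u) (λ _ → refl) a b ⟩
  evBracketA (λ w → h (w ++ u)) a b + evBracketA (λ w → ∂* w h u) a b
    ≡⟨ cong (evBracketA (λ w → h (w ++ u)) a b +_) (sym (∂*-commutator a b u h)) ⟩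
  ((P a b - P b a) + (h ((a ++ b) ++ u) - h ((b ++ a) ++ u))) + (N a b - N b a)
    ≡⟨ cong₂ (λ x y → ((P a b - P b a) + (h x - h y)) + (N a b - N b a))
             (ListP.++-assoc a b u) (ListP.++-assoc b a u) ⟩
  ((P a b - P b a) + (H a b - H b a)) + (N a b - N b a)
    ≡⟨ solve 8 (λ p p′ x x′ n n′ m m′ → ((p :- p′) :+ (x :- x′)) :+ (n :- n′)
                                       := ((x :+ (p :+ m)) :+ (m′ :+ n)) :- ((x′ :+ (p′ :+ m′)) :+ (m :+ n′))) refl
         (P a b) (P b a) (H a b) (H b a) (N a b) (N b a) (M a b) (M b a) ⟩
  ((H a b + (P a b + M a b)) + (M b a + N a b)) - ((H b a + (P b a + M b a)) + (M a b + N b a))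
    ≡⟨ sym (cong₂ _-_ (σ*word-∘ a b h u) (σ*word-∘ b a h u)) ⟩
  σ*word b (σ*word a h) u - σ*word a (σ*word b h) u ∎
  where
  H P M N : Word → Word → ℚ
  H p q = h (p ++ q ++ u)
  P p q = ∂* p (λ z → h (z ++ u)) q
  M p q = ∂* p (λ z → h (q ++ z)) u
  N p q = ∂* q (∂* p h) u

ev₂ : Poly → Poly → (Word → Word → ℚ) → ℚ
ev₂ ψ φ F = ev (λ a → ev (F a) φ) ψ

ev₂-+ : ∀ ψ φ F F′ → ev₂ ψ φ (λ a b → F a b + F′ a b) ≡ ev₂ ψ φ F + ev₂ ψ φ F′
ev₂-+ ψ φ F F′ =
  trans (ev-cong ψ (λ a → ev-+ (F a) (F′ a) φ)) (ev-+ (λ a → ev (F a) φ) (λ a → ev (F′ a) φ) ψ)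

ev₂-- : ∀ ψ φ F F′ → ev₂ ψ φ (λ a b → F a b - F′ a b) ≡ ev₂ ψ φ F - ev₂ ψ φ F′
ev₂-- ψ φ F F′ =
  trans (ev-cong ψ (λ a → ev-- (F a) (F′ a) φ)) (ev-- (λ a → ev (F a) φ) (λ a → ev (F′ a) φ) ψ)

ev-∂ : ∀ h ψ f → ev h (∂ ψ f) ≡ ev₂ ψ f (λ w → ∂* w h)
ev-∂ h [] f = refl
ev-∂ h ((c , w) ∷ ψ) f = trans (ev-++ h (row f) (∂ ψ f)) (cong₂ _+_ (ev-row f) (ev-∂ h ψ f))
  where
  row : Poly → Poly
  row = concatMap (λ { (d , u) → (c * d) · ∂word w u })
  ev-row : ∀ f → ev h (row f) ≡ c * ev (∂* w h) f
  ev-row [] = sym (ℚP.*-zeroʳ c)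
  ev-row ((d , u) ∷ f) = begin
    ev h ((c * d) · ∂word w u ++ row f)
      ≡⟨ ev-++ h ((c * d) · ∂word w u) (row f) ⟩
    ev h ((c * d) · ∂word w u) + ev h (row f)
      ≡⟨ cong₂ _+_ (ev-· h (c * d) (∂word w u)) (ev-row f) ⟩
    (c * d) * ∂* w h u + c * ev (∂* w h) f
      ≡⟨ solve 4 (λ c d x y → c :* d :* x :+ c :* y := c :* (d :* x :+ y)) refl c d (∂* w h u) (ev (∂* w h) f) ⟩
    c * (d * ∂* w h u + ev (∂* w h) f) ∎

σ* : Poly → Functional → Functional
σ* ψ h u = ev (λ w → σ*word w h u) ψ

ev-σ : ∀ h ψ f → ev h (σ ψ f) ≡ ev (σ* ψ h) f
ev-σ h ψ f = begin
  ev h (ψ ⊛ f ++ ∂ ψ f)                                  ≡⟨ ev-++ h (ψ ⊛ f) (∂ ψ f) ⟩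
  ev h (ψ ⊛ f) + ev h (∂ ψ f)                            ≡⟨ cong₂ _+_ (ev-⊛ h ψ f) (ev-∂ h ψ f) ⟩
  ev₂ ψ f (λ w u → h (w ++ u)) + ev₂ ψ f (λ w → ∂* w h)  ≡⟨ sym (ev₂-+ ψ f _ _) ⟩
  ev₂ ψ f (λ w u → σ*word w h u)                         ≡⟨ ev-swap (λ w u → σ*word w h u) ψ f ⟩
  ev (σ* ψ h) f                                          ∎

ev-⟪⟫A : ∀ G ψ φ → ev G ⟪ ψ , φ ⟫A ≡ ev₂ ψ φ (evBracketA G)
ev-⟪⟫A G ψ φ = begin
  ev G ((∂ ψ φ ⊖ ∂ φ ψ) ⊕ (ψ ⊛ φ ⊖ φ ⊛ ψ))
    ≡⟨ trans (ev-++ G (∂ ψ φ ⊖ ∂ φ ψ) (ψ ⊛ φ ⊖ φ ⊛ ψ))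
             (cong₂ _+_ (ev-⊖ G (∂ ψ φ) (∂ φ ψ)) (ev-⊖ G (ψ ⊛ φ) (φ ⊛ ψ))) ⟩
  (ev G (∂ ψ φ) - ev G (∂ φ ψ)) + (ev G (ψ ⊛ φ) - ev G (φ ⊛ ψ))
    ≡⟨ cong₂ (λ x y → (ev G (∂ ψ φ) - x) + (ev G (ψ ⊛ φ) - y))
             (trans (ev-∂ G φ ψ) (ev-swap (λ b a → ∂* b G a) φ ψ))
             (trans (ev-⊛ G φ ψ) (ev-swap (λ b a → G (b ++ a)) φ ψ)) ⟩
  (ev G (∂ ψ φ) - ev₂ ψ φ (λ a b → ∂* b G a)) + (ev G (ψ ⊛ φ) - ev₂ ψ φ (λ a b → G (b ++ a)))
    ≡⟨ cong₂ (λ x y → (x - ev₂ ψ φ (λ a b → ∂* b G a)) + (y - ev₂ ψ φ (λ a b → G (b ++ a))))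
             (ev-∂ G ψ φ) (ev-⊛ G ψ φ) ⟩
  (ev₂ ψ φ (λ a b → ∂* a G b) - ev₂ ψ φ (λ a b → ∂* b G a))
    + (ev₂ ψ φ (λ a b → G (a ++ b)) - ev₂ ψ φ (λ a b → G (b ++ a)))
    ≡⟨ sym (cong₂ _+_ (ev₂-- ψ φ (λ a b → ∂* a G b) (λ a b → ∂* b G a))
                      (ev₂-- ψ φ (λ a b → G (a ++ b)) (λ a b → G (b ++ a)))) ⟩
  ev₂ ψ φ (λ a b → ∂* a G b - ∂* b G a) + ev₂ ψ φ (λ a b → G (a ++ b) - G (b ++ a))
    ≡⟨ sym (ev₂-+ ψ φ (λ a b → ∂* a G b - ∂* b G a) (λ a b → G (a ++ b) - G (b ++ a))) ⟩
  ev₂ ψ φ (evBracketA G) ∎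

σ*word-ev : ∀ b ψ (F : Word → Functional) u →
            σ*word b (λ x → ev (λ a → F a x) ψ) u ≡ ev (λ a → σ*word b (F a) u) ψ
σ*word-ev b ψ F u = trans (cong (ev (λ a → F a (b ++ u)) ψ +_) (ev-swap (λ x a → F a x) (∂word b u) ψ))
                          (sym (ev-+ (λ a → F a (b ++ u)) (λ a → ∂* b (F a) u) ψ))

σ*-∘ : ∀ ψ φ h u → σ* φ (σ* ψ h) u ≡ ev₂ φ ψ (λ b a → σ*word b (σ*word a h) u)
σ*-∘ ψ φ h u = ev-cong φ (λ b → σ*word-ev b ψ (λ a → σ*word a h) u)

σ-linear : ∀ ψ (a b : ℚ) f g → σ ψ (a · f ⊕ b · g) ≈ a · σ ψ f ⊕ b · σ ψ g
σ-linear ψ a b f g = ev≡⇒≈ {σ ψ (a · f ⊕ b · g)} {a · σ ψ f ⊕ b · σ ψ g} λ h → begin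
  ev h (σ ψ (a · f ⊕ b · g))                   ≡⟨ ev-σ h ψ (a · f ⊕ b · g) ⟩
  ev (σ* ψ h) (a · f ⊕ b · g)                  ≡⟨ ev-lincomb (σ* ψ h) a b f g ⟩
  a * ev (σ* ψ h) f + b * ev (σ* ψ h) g        ≡⟨ sym (cong₂ (λ x y → a * x + b * y) (ev-σ h ψ f) (ev-σ h ψ g)) ⟩
  a * ev h (σ ψ f) + b * ev h (σ ψ g)          ≡⟨ sym (ev-lincomb h a b (σ ψ f) (σ ψ g)) ⟩
  ev h (a · σ ψ f ⊕ b · σ ψ g)                 ∎

σ-linearˡ : ∀ ψ φ (a b : ℚ) f → σ (a · ψ ⊕ b · φ) f ≈ a · σ ψ f ⊕ b · σ φ f
σ-linearˡ ψ φ a b f = ev≡⇒≈ {σ (a · ψ ⊕ b · φ) f} {a · σ ψ f ⊕ b · σ φ f} λ h → begin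
  ev h (σ (a · ψ ⊕ b · φ) f)                   ≡⟨ ev-σ h (a · ψ ⊕ b · φ) f ⟩
  ev (σ* (a · ψ ⊕ b · φ) h) f                  ≡⟨ ev-cong f (λ u → ev-lincomb (λ w → σ*word w h u) a b ψ φ) ⟩
  ev (λ u → a * σ* ψ h u + b * σ* φ h u) f     ≡⟨ ev-+ (λ u → a * σ* ψ h u) (λ u → b * σ* φ h u) f ⟩
  ev (λ u → a * σ* ψ h u) f + ev (λ u → b * σ* φ h u) f
                                               ≡⟨ cong₂ _+_ (ev-* a (σ* ψ h) f) (ev-* b (σ* φ h) f) ⟩
  a * ev (σ* ψ h) f + b * ev (σ* φ h) f        ≡⟨ sym (cong₂ (λ x y → a * x + b * y) (ev-σ h ψ f) (ev-σ h φ f)) ⟩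
  a * ev h (σ ψ f) + b * ev h (σ φ f)          ≡⟨ sym (ev-lincomb h a b (σ ψ f) (σ φ f)) ⟩
  ev h (a · σ ψ f ⊕ b · σ φ f)                 ∎

σ*-⟪⟫A : ∀ ψ φ h u → σ* ⟪ ψ , φ ⟫A h u ≡ σ* φ (σ* ψ h) u - σ* ψ (σ* φ h) u
σ*-⟪⟫A ψ φ h u = begin
  ev (λ w → σ*word w h u) ⟪ ψ , φ ⟫A
    ≡⟨ ev-⟪⟫A (λ w → σ*word w h u) ψ φ ⟩
  ev₂ ψ φ (evBracketA (λ w → σ*word w h u))
    ≡⟨ ev-cong ψ (λ a → ev-cong φ (λ b → σ*word-commutator a b u h)) ⟩
  ev₂ ψ φ (λ a b → σ*word b (σ*word a h) u - σ*word a (σ*word b h) u)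
    ≡⟨ ev₂-- ψ φ (λ a b → σ*word b (σ*word a h) u) (λ a b → σ*word a (σ*word b h) u) ⟩
  ev₂ ψ φ (λ a b → σ*word b (σ*word a h) u) - ev₂ ψ φ (λ a b → σ*word a (σ*word b h) u)
    ≡⟨ cong₂ _-_ (sym (trans (σ*-∘ ψ φ h u) (ev-swap (λ b a → σ*word b (σ*word a h) u) φ ψ)))
                 (sym (σ*-∘ φ ψ h u)) ⟩
  σ* φ (σ* ψ h) u - σ* ψ (σ* φ h) u ∎

σ-⟪⟫A : ∀ ψ φ f → σ ⟪ ψ , φ ⟫A f ≈ σ ψ (σ φ f) ⊖ σ φ (σ ψ f)
σ-⟪⟫A ψ φ f = ev≡⇒≈ {σ ⟪ ψ , φ ⟫A f} {σ ψ (σ φ f) ⊖ σ φ (σ ψ f)} λ h → begin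
  ev h (σ ⟪ ψ , φ ⟫A f)                            ≡⟨ ev-σ h ⟪ ψ , φ ⟫A f ⟩
  ev (σ* ⟪ ψ , φ ⟫A h) f                           ≡⟨ ev-cong f (σ*-⟪⟫A ψ φ h) ⟩
  ev (λ u → σ* φ (σ* ψ h) u - σ* ψ (σ* φ h) u) f   ≡⟨ ev-- (σ* φ (σ* ψ h)) (σ* ψ (σ* φ h)) f ⟩
  ev (σ* φ (σ* ψ h)) f - ev (σ* ψ (σ* φ h)) f      ≡⟨ sym (cong₂ _-_ (trans (ev-σ h ψ (σ φ f)) (ev-σ (σ* ψ h) φ f))
                                                                     (trans (ev-σ h φ (σ ψ f)) (ev-σ (σ* φ h) ψ f))) ⟩
  ev h (σ ψ (σ φ f)) - ev h (σ φ (σ ψ f))          ≡⟨ sym (ev-⊖ h (σ ψ (σ φ f)) (σ φ (σ ψ f))) ⟩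
  ev h (σ ψ (σ φ f) ⊖ σ φ (σ ψ f))                 ∎

lemma2p7 :
    -- each σ_ψ is a ℚ-linear endomorphism of ℚ⟨B⟩
    (∀ ψ → IsLie ψ → ∀ (a b : ℚ) f g → σ ψ (a · f ⊕ b · g) ≈ a · σ ψ f ⊕ b · σ ψ g)
    -- ψ ↦ σ_ψ is ℚ-linear on 𝔏𝔦𝔢(B)
    × (∀ ψ φ → IsLie ψ → IsLie φ → ∀ (a b : ℚ) f → σ (a · ψ ⊕ b · φ) f ≈ a · σ ψ f ⊕ b · σ φ f)
    -- σ_{ {ψ,φ}_A } = [σ_ψ , σ_φ] (commutator in End)
    × (∀ ψ φ → IsLie ψ → IsLie φ → ∀ f → σ ⟪ ψ , φ ⟫A f ≈ σ ψ (σ φ f) ⊖ σ φ (σ ψ f))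
lemma2p7 = (λ ψ _ → σ-linear ψ) , (λ ψ φ _ _ → σ-linearˡ ψ φ) , (λ ψ φ _ _ → σ-⟪⟫A ψ φ)
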